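{- Let $G$ be a bipartite graph with diameter three, with partite sets $V_1,V_2$ where $|V_1|=n_1$, $|V_2|=n_2$, and let $n=n_1+n_2$. Then $$Mo(G)\leq \sqrt{\frac{n_{1}^{2}n_{2}^{2}n^{2}}{3}+\left(\frac{2n_{1}^{2}n_{2}^{2}}{27}+\frac{n_{1}n_{2}n^{2}}{18}\right)\sqrt{4n_{1}^{2}n_{2}^{2}+3n_{1}n_{2}n^{2}}-\frac{4n_{1}^{3}n_{2}^{3}}{27}}.$$
   Context: All graphs are finite, simple and undirected; $d(x,y)$ is the graph distance. For an edge $e=(u,v)$, $n_e(u)$ is the number of vertices $w$ with $d(w,u)<d(w,v)$. The Mostar index is $Mo(G)=\sum_{e=(u,v)\in E(G)}|n_e(u)-n_e(v)|$. -}

module Defs where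

open import Data.Bool.Base using (Bool; true; false; _∧_; _∨_; if_then_else_; not)
open import Data.Nat.Base as ℕ using (ℕ; zero; suc; _<ᵇ_; ∣_-_∣)
open import Data.Fin.Base using (Fin; toℕ)
open import Data.Fin.Properties using (_≟_)
open import Data.List.Base using (List; allFin; map; concatMap)
open import Data.Bool.ListAction using (any)
open import Data.Nat.ListAction using (sum)
open import Data.Product.Base using (Σ; _×_; ∃)
open import Data.Sum.Base using (_⊎_)
open import Data.Integer.Base using (+_)
open import Data.Rational.Base as ℚ using (ℚ; _/_; 0ℚ; _+_; _*_; _-_)
open import Relation.Nullary.Decidable.Core using (⌊_⌋)
open import Relation.Binary.PropositionalEquality using (_≡_; _≢_)

record Graph (N : ℕ) : Set where
  field
    adj    : Fin N → Fin N → Bool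
    irrefl : ∀ v → adj v v ≡ false
    sym    : ∀ u v → adj u v ≡ adj v u
open Graph public

module _ {N : ℕ} (G : Graph N) where

  within : ℕ → Fin N → Fin N → Bool
  within zero    u v = ⌊ u ≟ v ⌋
  within (suc k) u v = within k u v ∨ any (λ w → adj G u w ∧ within k w v) (allFin N)

  distAux : ℕ → ℕ → Fin N → Fin N → ℕ
  distAux k zero     u v = k
  distAux k (suc f) u v = if within k u v then k else distAux (suc k) f u v

  -- graph distance d(u,v) (correct whenever u,v are connected; then d(u,v) ≤ N-1)
  dist : Fin N → Fin N → ℕ
  dist u v = distAux 0 (suc N) u v

  Connected : Set
  Connected = ∀ u v → within N u v ≡ true

  HasDiameter : ℕ → Set
  HasDiameter D = Connected × (∀ u v → dist u v ℕ.≤ D) × ∃ λ u → ∃ λ v → dist u v ≡ D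

  countV : (Fin N → Bool) → ℕ
  countV p = sum (map (λ w → if p w then 1 else 0) (allFin N))

  nₑ : Fin N → Fin N → ℕ
  nₑ u v = countV (λ w → dist w u <ᵇ dist w v)

  Mostar : ℕ
  Mostar = sum (concatMap (λ u → map (λ v →
             if adj G u v ∧ (toℕ u <ᵇ toℕ v) then ∣ nₑ u v - nₑ v u ∣ else 0)
             (allFin N)) (allFin N))

  -- side : Fin N → Bool is a bipartition (V₁ = side false, V₂ = side true)
  IsBipartition : (Fin N → Bool) → Set
  IsBipartition side = ∀ u v → adj G u v ≡ true → side u ≢ side v

ℕ→ℚ : ℕ → ℚ
ℕ→ℚ n = + n / 1

-- For x ≥ 0 and b, c ≥ 0 (reals):  x ≤ √(a + b·√c − d)  iff  x² − a + d ≤ b·√c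
-- iff  (x² − a + d ≤ 0)  or  ((x² − a + d)² ≤ b²·c).
-- LeSqrtNested x a b c d encodes  x ≤ √(a + b·√c − d)  for such arguments.
LeSqrtNested : ℚ → ℚ → ℚ → ℚ → ℚ → Set
LeSqrtNested x a b c d =
  let t = x * x - a + d in (t ℚ.≤ 0ℚ) ⊎ (t * t ℚ.≤ b * b * c)

module Submission where

-- In a connected bipartite graph the parity of d(w,u) is fixed by the sides of w and u, so when all
-- distances are at most 3, d(w,u) is 0 or 2 on u's side and 1 or 3, according to adjacency, on the
-- other side. For an edge uv this gives nₑ(u) = deg u + ν(v), with ν(v) the number of vertices on u's
-- side not adjacent to v, hence |nₑ(u) − nₑ(v)|² ≤ (n₁ − n₂)² + 4 deg u ν(v) + 4 ν(u) deg v.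
-- Cauchy–Schwarz over the M = 2|E| ordered edges, together with Σ ν = 2n₁n₂ − M, gives
-- 4 Mo² + 8M³ ≤ M²(n₁ − n₂)² + 16 n₁n₂ M². Maximising this cubic in M over [0, 2n₁n₂] gives the bound;
-- over ℚ the maximum is certified without square roots by 4Q³ = H² + 108 L² q with q ≥ 0.

open import Defs hiding (sym)
open import Data.Nat.Base using (ℕ; _+_)
open import Data.Bool.Base using (Bool; true; false; not)
open import Data.Fin.Base using (Fin)
open import Data.Integer.Base using (+_)
open import Data.Rational.Base using (ℚ; _/_) renaming (_+_ to _+ℚ_; _*_ to _*ℚ_)
open import Data.Product.Base using (_,_)
open import Relation.Binary.PropositionalEquality using (_≡_; refl; sym; trans; cong; cong₂; subst; subst₂)

module _ where
  open import Function.Base using (_∘_; id)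
  open import Data.Bool.Base using (Bool; true; false; not; _∧_; _∨_; _xor_; if_then_else_; T)
  open import Data.Bool.Properties
    using (∨-zeroʳ; ¬-not; xor-same; xor-inverseˡ; not-distribˡ-xor) renaming (_≟_ to _≟ᵇ_)
  open import Data.Bool.ListAction using (any)
  open import Data.Nat.Base as ℕ using (ℕ; zero; suc; _+_; _*_; _∸_; _≤_; z≤n; s≤s; _<ᵇ_; ∣_-_∣)
  open import Data.Nat.Properties as ℕ hiding (_≟_)
  import Data.Nat.ListAction as List
  open import Data.Nat.ListAction.Properties using (sum-++)
  open import Data.Nat.Tactic.RingSolver using (solve)
  open import Algebra.Properties.Semiring.Sum ℕ.+-*-semiring
    using (sum; sum-syntax; ∑-distrib-+; ∑-comm; *-distribˡ-sum; sum-cong-≗; sum-replicate-zero)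
  open import Data.Fin.Base using (Fin; zero; suc; toℕ)
  open import Data.Fin.Properties using (_≟_)
  open import Data.List.Base using (List; []; _∷_; map; concat; concatMap; allFin; tabulate)
  open import Data.List.Properties using (map-tabulate; map-∘)
  open import Data.List.Membership.Propositional using (_∈_)
  open import Data.List.Membership.Propositional.Properties using (∈-allFin)
  open import Data.List.Relation.Unary.Any using (here; there)
  open import Data.Product.Base using (∃; _×_; _,_)
  open import Data.Sum.Base using (_⊎_; inj₁; inj₂)
  open import Data.Empty using (⊥-elim)
  open import Relation.Nullary using (Dec; yes; no)
  open import Relation.Nullary.Decidable.Core using (⌊_⌋)
  open import Relation.Binary.PropositionalEquality

  -- Sums over Fin n

  sum-tabulate : ∀ {n} (f : Fin n → ℕ) → List.sum (tabulate f) ≡ ∑[ i < n ] f i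
  sum-tabulate {zero}  f = refl
  sum-tabulate {suc n} f = cong (_+_ (f zero)) (sum-tabulate (f ∘ suc))

  sum-map-allFin : ∀ {n} (f : Fin n → ℕ) → List.sum (map f (allFin n)) ≡ ∑[ i < n ] f i
  sum-map-allFin f = trans (cong List.sum (map-tabulate id f)) (sum-tabulate f)

  sum-concat : ∀ (xss : List (List ℕ)) → List.sum (concat xss) ≡ List.sum (map List.sum xss)
  sum-concat []         = refl
  sum-concat (xs ∷ xss) = trans (sum-++ xs (concat xss)) (cong (_+_ (List.sum xs)) (sum-concat xss))

  sum-concatMap-allFin : ∀ {m n} (h : Fin m → Fin n → ℕ) →
    List.sum (concatMap (λ u → map (h u) (allFin n)) (allFin m)) ≡ ∑[ u < m ] ∑[ v < n ] h u v
  sum-concatMap-allFin {m} {n} h = begin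
    List.sum (concat (map row (allFin m)))            ≡⟨ sum-concat (map row (allFin m)) ⟩
    List.sum (map List.sum (map row (allFin m)))      ≡⟨ cong List.sum (map-∘ (allFin m)) ⟨
    List.sum (map (List.sum ∘ row) (allFin m))        ≡⟨ sum-map-allFin (List.sum ∘ row) ⟩
    ∑[ u < m ] List.sum (row u)                       ≡⟨ sum-cong-≗ (λ u → sum-map-allFin (h u)) ⟩
    ∑[ u < m ] ∑[ v < n ] h u v                       ∎
    where
    open ≡-Reasoning
    row : Fin m → List ℕ
    row u = map (h u) (allFin n)

  ∑-mono-≤ : ∀ {n} {f g : Fin n → ℕ} → (∀ i → f i ≤ g i) → ∑[ i < n ] f i ≤ ∑[ i < n ] g i
  ∑-mono-≤ {zero}  f≤g = z≤n
  ∑-mono-≤ {suc n} f≤g = +-mono-≤ (f≤g zero) (∑-mono-≤ (f≤g ∘ suc))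

  ∑-distrib-+₃ : ∀ {n} (f g h : Fin n → ℕ) →
    ∑[ i < n ] (f i + g i + h i) ≡ ∑[ i < n ] f i + ∑[ i < n ] g i + ∑[ i < n ] h i
  ∑-distrib-+₃ f g h = trans (∑-distrib-+ (λ i → f i + g i) h) (cong (_+ sum h) (∑-distrib-+ f g))

  ∑-linear₃ : ∀ {n} a b c (f g h : Fin n → ℕ) →
    ∑[ i < n ] (a * f i + b * g i + c * h i) ≡ a * ∑[ i < n ] f i + b * ∑[ i < n ] g i + c * ∑[ i < n ] h i
  ∑-linear₃ a b c f g h = trans (∑-distrib-+₃ (λ i → a * f i) (λ i → b * g i) (λ i → c * h i))
    (sym (cong₂ _+_ (cong₂ _+_ (*-distribˡ-sum a f) (*-distribˡ-sum b g)) (*-distribˡ-sum c h)))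

  ind : Bool → ℕ
  ind b = if b then 1 else 0

  ∑-ind-≟ : ∀ {n} (j : Fin n) → ∑[ i < n ] ind ⌊ i ≟ j ⌋ ≡ 1
  ∑-ind-≟ {suc n} zero    = cong suc (sum-replicate-zero n)
  ∑-ind-≟ {suc n} (suc j) = trans (sum-cong-≗ suc-≟) (∑-ind-≟ j)
    where
    suc-≟ : ∀ (i : Fin n) → ind ⌊ suc i ≟ suc j ⌋ ≡ ind ⌊ i ≟ j ⌋
    suc-≟ i with i ≟ j
    ... | yes _ = refl
    ... | no _  = refl

  ∣m-n∣²+4mn≡[m+n]² : ∀ m n → ∣ m - n ∣ * ∣ m - n ∣ + 4 * (m * n) ≡ (m + n) * (m + n)
  ∣m-n∣²+4mn≡[m+n]² m n with ≤-total m n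
  ... | inj₁ m≤n with d , refl ← m≤n⇒∃[o]m+o≡n m≤n rewrite ∣m-m+n∣≡n m d = solve (m ∷ d ∷ [])
  ... | inj₂ n≤m with d , refl ← m≤n⇒∃[o]m+o≡n n≤m rewrite ∣-∣-comm (n + d) n | ∣m-m+n∣≡n n d = solve (n ∷ d ∷ [])

  4mn≤[m+n]² : ∀ m n → 4 * (m * n) ≤ (m + n) * (m + n)
  4mn≤[m+n]² m n = subst (4 * (m * n) ≤_) (∣m-n∣²+4mn≡[m+n]² m n) (m≤n+m _ (∣ m - n ∣ * ∣ m - n ∣))

  *-self-cancel-≤ : ∀ {m n} → m * m ≤ n * n → m ≤ n
  *-self-cancel-≤ {m} {n} m²≤n² with m ≤? n
  ... | yes m≤n = m≤n
  ... | no m≰n  = ⊥-elim (<⇒≱ (*-mono-< (≰⇒> m≰n) (≰⇒> m≰n)) m²≤n²)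

  cauchy-schwarz : ∀ {n} (g c k : Fin n → ℕ) → (∀ i → g i * g i ≤ c i * k i) →
    ∑[ i < n ] g i * ∑[ i < n ] g i ≤ ∑[ i < n ] c i * ∑[ i < n ] k i
  cauchy-schwarz {zero}  g c k gg≤ck = z≤n
  cauchy-schwarz {suc n} g c k gg≤ck =
    step (g zero) (c zero) (k zero) (sum (g ∘ suc)) (sum (c ∘ suc)) (sum (k ∘ suc))
      (gg≤ck zero) (cauchy-schwarz (g ∘ suc) (c ∘ suc) (k ∘ suc) (gg≤ck ∘ suc))
    where
    step : ∀ a b e x y z → a * a ≤ b * e → x * x ≤ y * z → (a + x) * (a + x) ≤ (b + y) * (e + z)
    step a b e x y z aa≤be xx≤yz = begin
      (a + x) * (a + x)               ≡⟨ solve (a ∷ x ∷ []) ⟩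
      a * a + x * x + 2 * (a * x)     ≤⟨ +-mono-≤ (+-mono-≤ aa≤be xx≤yz) 2ax≤bz+ye ⟩
      b * e + y * z + (b * z + y * e) ≡⟨ solve (b ∷ e ∷ y ∷ z ∷ []) ⟩
      (b + y) * (e + z)               ∎
      where
      open ≤-Reasoning
      2ax≤bz+ye : 2 * (a * x) ≤ b * z + y * e
      2ax≤bz+ye = *-self-cancel-≤ (begin
        2 * (a * x) * (2 * (a * x))     ≡⟨ solve (a ∷ x ∷ []) ⟩
        4 * ((a * a) * (x * x))         ≤⟨ *-monoʳ-≤ 4 (*-mono-≤ aa≤be xx≤yz) ⟩
        4 * ((b * e) * (y * z))         ≡⟨ solve (b ∷ e ∷ y ∷ z ∷ []) ⟩
        4 * ((b * z) * (y * e))         ≤⟨ 4mn≤[m+n]² (b * z) (y * e) ⟩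
        (b * z + y * e) * (b * z + y * e) ∎)

  mostar-cubic-form : ∀ {mo m k p a} → 4 * (mo * mo) ≤ m * (a * a * m + 4 * k * m + 4 * m * k) → k + m ≡ 2 * p →
    4 * (mo * mo) + 8 * (m * m * m) ≤ m * m * (a * a) + 16 * p * (m * m)
  mostar-cubic-form {mo} {m} {k} {p} {a} h k+m≡2p = begin
    4 * (mo * mo) + 8 * (m * m * m)                              ≤⟨ +-monoˡ-≤ (8 * (m * m * m)) h ⟩
    m * (a * a * m + 4 * k * m + 4 * m * k) + 8 * (m * m * m)    ≡⟨ solve (m ∷ k ∷ a ∷ []) ⟩
    m * m * (a * a) + 8 * (m * m) * (k + m)                      ≡⟨ cong (λ x → m * m * (a * a) + 8 * (m * m) * x) k+m≡2p ⟩
    m * m * (a * a) + 8 * (m * m) * (2 * p)                      ≡⟨ solve (m ∷ p ∷ a ∷ []) ⟩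
    m * m * (a * a) + 16 * p * (m * m)                           ∎
    where open ≤-Reasoning

  ∣m-n∣²+4mn-invariant : ∀ {m n m′ n′} → m + n ≡ m′ + n′ →
    ∣ m - n ∣ * ∣ m - n ∣ + 4 * (m * n) ≡ ∣ m′ - n′ ∣ * ∣ m′ - n′ ∣ + 4 * (m′ * n′)
  ∣m-n∣²+4mn-invariant {m} {n} {m′} {n′} eq = begin
    ∣ m - n ∣ * ∣ m - n ∣ + 4 * (m * n)         ≡⟨ ∣m-n∣²+4mn≡[m+n]² m n ⟩
    (m + n) * (m + n)                           ≡⟨ cong (λ s → s * s) eq ⟩
    (m′ + n′) * (m′ + n′)                       ≡⟨ ∣m-n∣²+4mn≡[m+n]² m′ n′ ⟨
    ∣ m′ - n′ ∣ * ∣ m′ - n′ ∣ + 4 * (m′ * n′)   ∎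
    where open ≡-Reasoning

  edge-square-bound : ∀ du dv α β →
    ∣ α + du - β + dv ∣ * ∣ α + du - β + dv ∣ ≤ ∣ dv + α - du + β ∣ * ∣ dv + α - du + β ∣ + 4 * du * α + 4 * β * dv
  edge-square-bound du dv α β =
    bound (∣ α + du - β + dv ∣ * ∣ α + du - β + dv ∣) (∣ dv + α - du + β ∣ * ∣ dv + α - du + β ∣)
      (∣m-n∣²+4mn-invariant {α + du} {β + dv} {dv + α} {du + β} (solve (du ∷ dv ∷ α ∷ β ∷ [])))
    where
    bound : ∀ e f → e + 4 * ((α + du) * (β + dv)) ≡ f + 4 * ((dv + α) * (du + β)) →
            e ≤ f + 4 * du * α + 4 * β * dv
    bound e f eq = +-cancelʳ-≤ (4 * ((α + du) * (β + dv))) e _ (begin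
      e + 4 * ((α + du) * (β + dv))                                 ≤⟨ m≤m+n _ (4 * (α * dv + du * β)) ⟩
      e + 4 * ((α + du) * (β + dv)) + 4 * (α * dv + du * β)         ≡⟨ cong (_+ 4 * (α * dv + du * β)) eq ⟩
      f + 4 * ((dv + α) * (du + β)) + 4 * (α * dv + du * β)         ≡⟨ solve (f ∷ du ∷ dv ∷ α ∷ β ∷ []) ⟩
      f + 4 * du * α + 4 * β * dv + 4 * ((α + du) * (β + dv))       ∎)
      where open ≤-Reasoning

  -- Graph distances

  any-true : ∀ {a} {A : Set a} (p : A → Bool) {xs x} → x ∈ xs → p x ≡ true → any p xs ≡ true
  any-true p (here refl) px rewrite px = refl
  any-true p {y ∷ _} (there x∈xs) px rewrite any-true p x∈xs px = ∨-zeroʳ (p y)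

  any-witness : ∀ {a} {A : Set a} (p : A → Bool) xs → any p xs ≡ true → ∃ λ x → p x ≡ true
  any-witness p (x ∷ xs) h with p x in px
  ... | true  = x , px
  ... | false = any-witness p xs h

  ∨-true : ∀ b c → b ∨ c ≡ true → b ≡ true ⊎ c ≡ true
  ∨-true true  c h = inj₁ refl
  ∨-true false c h = inj₂ h

  ∧-true : ∀ {b c} → b ∧ c ≡ true → b ≡ true × c ≡ true
  ∧-true {true} {true} h = refl , refl

  ≟-true : ∀ {n} {i j : Fin n} → ⌊ i ≟ j ⌋ ≡ true → i ≡ j
  ≟-true {i = i} {j} h with i ≟ j
  ... | yes i≡j = i≡j

  ≟-refl : ∀ {n} (i : Fin n) → ⌊ i ≟ i ⌋ ≡ true
  ≟-refl i with i ≟ i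
  ... | yes _  = refl
  ... | no i≢i = ⊥-elim (i≢i refl)

  ≟-≢ : ∀ {n} {i j : Fin n} → i ≢ j → ⌊ i ≟ j ⌋ ≡ false
  ≟-≢ {i = i} {j} i≢j with i ≟ j
  ... | yes i≡j = ⊥-elim (i≢j i≡j)
  ... | no _    = refl

  isOdd : ℕ → Bool
  isOdd zero    = false
  isOdd (suc n) = not (isOdd n)

  not-xor-flip : ∀ {a b} c → a ≢ b → not (b xor c) ≡ a xor c
  not-xor-flip {a} {b} c a≢b = trans (not-distribˡ-xor b c) (cong (_xor c) (sym (¬-not a≢b)))

  module Distance {N : ℕ} (G : Graph N) where

    within-suc : ∀ {k u v} → within G k u v ≡ true → within G (suc k) u v ≡ true
    within-suc h rewrite h = refl

    within-step : ∀ {k u w v} → adj G u w ≡ true → within G k w v ≡ true → within G (suc k) u v ≡ true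
    within-step {k} {u} {w} {v} uw wv =
      trans (cong (within G k u v ∨_) (any-true _ (∈-allFin w) (cong₂ _∧_ uw wv))) (∨-zeroʳ _)

    distAux-least : ∀ {j u v} k f → within G j u v ≡ true → k ≤ j → distAux G k f u v ≤ j
    distAux-least {j} {u} {v} k zero    h k≤j = k≤j
    distAux-least {j} {u} {v} k (suc f) h k≤j with within G k u v in wk
    ... | true  = k≤j
    ... | false = distAux-least (suc k) f h (≤∧≢⇒< k≤j k≢j)
      where
      k≢j : k ≢ j
      k≢j refl with () ← trans (sym h) wk

    distAux-within : ∀ {u v} k f → within G (k + f) u v ≡ true → within G (distAux G k f u v) u v ≡ true
    distAux-within {u} {v} k zero    h rewrite +-identityʳ k = h
    distAux-within {u} {v} k (suc f) h with within G k u v in wk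
    ... | true  = wk
    ... | false = distAux-within (suc k) f (subst (λ i → within G i u v ≡ true) (+-suc k f) h)

    distAux-≥ : ∀ {u v} k f → k ≤ distAux G k f u v
    distAux-≥ {u} {v} k zero    = ≤-refl
    distAux-≥ {u} {v} k (suc f) with within G k u v
    ... | true  = ≤-refl
    ... | false = ≤-trans (n≤1+n k) (distAux-≥ (suc k) f)

    dist-refl : ∀ u → dist G u u ≡ 0
    dist-refl u rewrite ≟-refl u = refl

    dist-pos : ∀ {u v} → u ≢ v → 1 ≤ dist G u v
    dist-pos {u} {v} u≢v rewrite ≟-≢ u≢v = distAux-≥ 1 N

    dist-least : ∀ {j u v} → within G j u v ≡ true → dist G u v ≤ j
    dist-least {j} {u} {v} h = distAux-least {j} {u} {v} 0 (suc N) h z≤n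

    adj⇒dist≤1 : ∀ {u v} → adj G u v ≡ true → dist G u v ≤ 1
    adj⇒dist≤1 {u} {v} uv = dist-least (within-step {0} {u} {v} {v} uv (≟-refl v))

    module _ (connected : Connected G) where

      dist-within : ∀ u v → within G (dist G u v) u v ≡ true
      dist-within u v = distAux-within 0 (suc N) (within-suc {N} {u} {v} (connected u v))

      dist≡1⇒adj : ∀ {u v} → dist G u v ≡ 1 → adj G u v ≡ true
      dist≡1⇒adj {u} {v} d≡1 with ∨-true _ _ (subst (λ i → within G i u v ≡ true) d≡1 (dist-within u v))
      ... | inj₁ u≟v with refl ← ≟-true {i = u} {v} u≟v with () ← trans (sym d≡1) (dist-refl u)
      ... | inj₂ h with w , uw∧wv ← any-witness _ (allFin N) h with uw , w≟v ← ∧-true uw∧wv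
                   with refl ← ≟-true {i = w} {v} w≟v = uw

      module _ {side : Fin N → Bool} (bipartite : IsBipartition G side) where

        within-parity : ∀ k {u v} → within G k u v ≡ true →
          ∃ λ j → j ≤ k × within G j u v ≡ true × isOdd j ≡ side u xor side v
        within-parity zero {u} {v} h with refl ← ≟-true {i = u} {v} h = 0 , z≤n , h , sym (xor-same (side u))
        within-parity (suc k) {u} {v} h with ∨-true _ _ h
        ... | inj₁ hk with j , j≤k , wj , oj ← within-parity k hk = j , m≤n⇒m≤1+n j≤k , wj , oj
        ... | inj₂ h′ with w , uw∧wk ← any-witness _ (allFin N) h′ with uw , wk ← ∧-true uw∧wk
                      with j , j≤k , wj , oj ← within-parity k wk
          = suc j , s≤s j≤k , within-step {j} {u} {w} {v} uw wj , trans (cong not oj) (not-xor-flip (side v) (bipartite u w uw))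

        dist-parity : ∀ u v → isOdd (dist G u v) ≡ side u xor side v
        dist-parity u v with j , j≤d , wj , oj ← within-parity (dist G u v) (dist-within u v)
          = subst (λ i → isOdd i ≡ side u xor side v) (≤-antisym j≤d (dist-least wj)) oj

  -- Bipartite graphs of diameter three

  even≤3 : ∀ {d} → d ≤ 3 → isOdd d ≡ false → 1 ≤ d → d ≡ 2
  even≤3 {2} _ _ _ = refl
  even≤3 {suc (suc (suc (suc _)))} (s≤s (s≤s (s≤s ()))) _ _

  odd≤3 : ∀ {d} → d ≤ 3 → isOdd d ≡ true → d ≡ 1 ⊎ d ≡ 3
  odd≤3 {1} _ _ = inj₁ refl
  odd≤3 {3} _ _ = inj₂ refl
  odd≤3 {suc (suc (suc (suc _)))} (s≤s (s≤s (s≤s ()))) _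

  xor-≢ : ∀ {a b} → a ≢ b → a xor b ≡ true
  xor-≢ {b = b} a≢b rewrite ¬-not a≢b = xor-inverseˡ b

  module Diameter3 {N : ℕ} (G : Graph N) {side : Fin N → Bool} (bipartite : IsBipartition G side)
                   (connected : Connected G) (dist≤3 : ∀ u v → dist G u v ≤ 3) where
    open Distance G

    adj-sym : ∀ {u v} → adj G u v ≡ true → adj G v u ≡ true
    adj-sym {u} {v} uv = trans (Graph.sym G v u) uv

    same-side⇒¬adj : ∀ {u w} → side u ≡ side w → adj G u w ≡ false
    same-side⇒¬adj {u} {w} su≡sw with adj G u w in uw
    ... | true  = ⊥-elim (bipartite u w uw su≡sw)
    ... | false = refl

    dist-same-side : ∀ {w u} → w ≢ u → side w ≡ side u → dist G w u ≡ 2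
    dist-same-side {w} {u} w≢u sw≡su = even≤3 (dist≤3 w u) even (dist-pos w≢u)
      where
      even : isOdd (dist G w u) ≡ false
      even = trans (dist-parity connected bipartite w u) (trans (cong (_xor side u) sw≡su) (xor-same (side u)))

    dist-other-side : ∀ {w u} → side w ≢ side u → dist G w u ≡ (if adj G w u then 1 else 3)
    dist-other-side {w} {u} sw≢su with odd≤3 (dist≤3 w u) (trans (dist-parity connected bipartite w u) (xor-≢ sw≢su))
                                     | adj G w u in wu
    ... | inj₁ d≡1 | true  = d≡1
    ... | inj₂ d≡3 | true  with s≤s () ← subst (_≤ 1) d≡3 (adj⇒dist≤1 wu)
    ... | inj₁ d≡1 | false with () ← trans (sym (dist≡1⇒adj connected d≡1)) wu
    ... | inj₂ d≡3 | false = d≡3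

    inPart : Bool → Fin N → Bool
    inPart true  = side
    inPart false = not ∘ side

    inPart-side : ∀ {b w} → side w ≡ b → inPart b w ≡ true
    inPart-side {true}  sw≡b = sw≡b
    inPart-side {false} sw≡b = cong not sw≡b

    inPart-not : ∀ {b w} → side w ≡ not b → inPart b w ≡ false
    inPart-not {true}  sw≡¬b = sw≡¬b
    inPart-not {false} sw≡¬b = cong not sw≡¬b

    adj⇒side≡not : ∀ {u v} → adj G u v ≡ true → side v ≡ not (side u)
    adj⇒side≡not {u} {v} uv = ¬-not (λ sv≡su → bipartite u v uv (sym sv≡su))

    -- Summed over w, the two sides are nₑ(u) + deg v + 1 and |part of u| + deg u + 1.
    Balanced : Fin N → Fin N → Fin N → Set
    Balanced u v w = ind (dist G w u <ᵇ dist G w v) + ind (adj G v w) + ind ⌊ w ≟ v ⌋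
                   ≡ ind (inPart (side u) w) + ind (adj G u w) + ind ⌊ w ≟ u ⌋

    -- The case w ≟ u is passed in rather than split on with `with`, which would also abstract the
    -- ⌊ w ≟ u ⌋ hidden in the unfolding of dist G w u.
    balanced-own-side : ∀ {u v w} → adj G u v ≡ true → side w ≡ side u → Dec (w ≡ u) → Balanced u v w
    balanced-own-side {u} {v} {w} uv _ (yes refl)
      rewrite dist-refl w | dist-other-side (bipartite w v uv) | uv | Graph.sym G v w | uv
            | ≟-≢ (λ w≡v → bipartite w v uv (cong side w≡v)) | inPart-side {side w} {w} refl | Graph.irrefl G w
            | ≟-refl w
      = refl
    balanced-own-side {u} {v} {w} uv sw≡su (no w≢u)
      rewrite dist-same-side w≢u sw≡su | dist-other-side {w} {v} (λ sw≡sv → bipartite u v uv (trans (sym sw≡su) sw≡sv))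
            | Graph.sym G v w | ≟-≢ (λ w≡v → bipartite u v uv (trans (sym sw≡su) (cong side w≡v)))
            | inPart-side {side u} {w} sw≡su | same-side⇒¬adj {u} {w} (sym sw≡su) | ≟-≢ w≢u
      with adj G w v
    ... | true  = refl
    ... | false = refl

    balanced-other-side : ∀ {u v w} → adj G u v ≡ true → side w ≡ side v → Dec (w ≡ v) → Balanced u v w
    balanced-other-side {u} {v} {w} uv _ (yes refl)
      rewrite dist-refl w | Graph.irrefl G w | ≟-refl w | inPart-not {side u} {w} (adj⇒side≡not uv) | uv
            | ≟-≢ (λ w≡u → bipartite u w uv (cong side (sym w≡u)))
      = refl
    balanced-other-side {u} {v} {w} uv sw≡sv (no w≢v)
      rewrite dist-same-side w≢v sw≡sv | dist-other-side {w} {u} (λ sw≡su → bipartite u v uv (trans (sym sw≡su) sw≡sv))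
            | same-side⇒¬adj {v} {w} (sym sw≡sv) | ≟-≢ w≢v | inPart-not {side u} {w} (trans sw≡sv (adj⇒side≡not uv))
            | Graph.sym G u w | ≟-≢ (λ w≡u → bipartite u v uv (trans (cong side (sym w≡u)) sw≡sv))
      with adj G w u
    ... | true  = refl
    ... | false = refl

    balanced : ∀ {u v} → adj G u v ≡ true → ∀ w → Balanced u v w
    balanced {u} {v} uv w with side w ≟ᵇ side u
    ... | yes sw≡su = balanced-own-side uv sw≡su (w ≟ u)
    ... | no sw≢su  = balanced-other-side uv (trans (¬-not sw≢su) (sym (adj⇒side≡not uv))) (w ≟ v)

    deg : Fin N → ℕ
    deg u = ∑[ v < N ] ind (adj G u v)

    part : Bool → ℕ
    part b = countV G (inPart b)

    countV≡∑ : ∀ p → countV G p ≡ ∑[ w < N ] ind (p w)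
    countV≡∑ p = sum-map-allFin (λ w → ind (p w))

    nₑ+deg≡part+deg : ∀ {u v} → adj G u v ≡ true → nₑ G u v + deg v ≡ part (side u) + deg u
    nₑ+deg≡part+deg {u} {v} uv = +-cancelʳ-≡ 1 _ _ (begin
      nₑ G u v + deg v + 1
        ≡⟨ cong₂ (λ x y → x + deg v + y) (countV≡∑ _) (sym (∑-ind-≟ v)) ⟩
      ∑[ w < N ] ind (dist G w u <ᵇ dist G w v) + deg v + ∑[ w < N ] ind ⌊ w ≟ v ⌋
        ≡⟨ ∑-distrib-+₃ (λ w → ind (dist G w u <ᵇ dist G w v)) (λ w → ind (adj G v w)) (λ w → ind ⌊ w ≟ v ⌋) ⟨
      ∑[ w < N ] (ind (dist G w u <ᵇ dist G w v) + ind (adj G v w) + ind ⌊ w ≟ v ⌋)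
        ≡⟨ sum-cong-≗ (balanced uv) ⟩
      ∑[ w < N ] (ind (inPart (side u) w) + ind (adj G u w) + ind ⌊ w ≟ u ⌋)
        ≡⟨ ∑-distrib-+₃ (λ w → ind (inPart (side u) w)) (λ w → ind (adj G u w)) (λ w → ind ⌊ w ≟ u ⌋) ⟩
      ∑[ w < N ] ind (inPart (side u) w) + deg u + ∑[ w < N ] ind ⌊ w ≟ u ⌋
        ≡⟨ cong₂ (λ x y → x + deg u + y) (sym (countV≡∑ _)) (∑-ind-≟ u) ⟩
      part (side u) + deg u + 1 ∎)
      where open ≡-Reasoning

    oppositePart : Fin N → ℕ
    oppositePart u = part (not (side u))

    deg≤oppositePart : ∀ u → deg u ≤ oppositePart u
    deg≤oppositePart u = subst (deg u ≤_) (sym (countV≡∑ _)) (∑-mono-≤ adj≤inPart)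
      where
      adj≤inPart : ∀ v → ind (adj G u v) ≤ ind (inPart (not (side u)) v)
      adj≤inPart v with adj G u v in uv
      ... | true  rewrite inPart-side {not (side u)} {v} (adj⇒side≡not uv) = ≤-refl
      ... | false = z≤n

    nonNeighbours : Fin N → ℕ
    nonNeighbours u = oppositePart u ∸ deg u

    part≡deg+nonNeighbours : ∀ {u v} → adj G u v ≡ true → part (side u) ≡ deg v + nonNeighbours v
    part≡deg+nonNeighbours {u} {v} uv =
      trans (cong part (adj⇒side≡not (adj-sym uv))) (sym (m+[n∸m]≡n (deg≤oppositePart v)))

    nₑ≡nonNeighbours+deg : ∀ {u v} → adj G u v ≡ true → nₑ G u v ≡ nonNeighbours v + deg u
    nₑ≡nonNeighbours+deg {u} {v} uv = +-cancelʳ-≡ (deg v) _ _ (begin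
      nₑ G u v + deg v                   ≡⟨ nₑ+deg≡part+deg uv ⟩
      part (side u) + deg u              ≡⟨ cong (_+ deg u) (part≡deg+nonNeighbours uv) ⟩
      deg v + nonNeighbours v + deg u    ≡⟨ +-assoc (deg v) (nonNeighbours v) (deg u) ⟩
      deg v + (nonNeighbours v + deg u)  ≡⟨ +-comm (deg v) _ ⟩
      nonNeighbours v + deg u + deg v    ∎)
      where open ≡-Reasoning

    imbalance : ℕ
    imbalance = ∣ part false - part true ∣

    ∣part-part∣≡imbalance : ∀ {u v} → adj G u v ≡ true → ∣ part (side u) - part (side v) ∣ ≡ imbalance
    ∣part-part∣≡imbalance {u} {v} uv rewrite adj⇒side≡not uv with side u
    ... | true  = ∣-∣-comm (part true) (part false)
    ... | false = refl

    nₑ-gap : Fin N → Fin N → ℕ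
    nₑ-gap u v = ∣ nₑ G u v - nₑ G v u ∣

    nₑ-gap-bound : ∀ {u v} → adj G u v ≡ true →
      nₑ-gap u v * nₑ-gap u v ≤ imbalance * imbalance + 4 * deg u * nonNeighbours v + 4 * nonNeighbours u * deg v
    nₑ-gap-bound {u} {v} uv
      rewrite nₑ≡nonNeighbours+deg uv | nₑ≡nonNeighbours+deg (adj-sym uv) | sym (∣part-part∣≡imbalance uv)
            | part≡deg+nonNeighbours uv | part≡deg+nonNeighbours (adj-sym uv)
      = edge-square-bound (deg u) (deg v) (nonNeighbours v) (nonNeighbours u)

    M K : ℕ
    M = ∑[ u < N ] deg u
    K = ∑[ u < N ] nonNeighbours u

    K+M≡2n₁n₂ : K + M ≡ 2 * (part false * part true)
    K+M≡2n₁n₂ = begin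
      K + M                                 ≡⟨ ∑-distrib-+ nonNeighbours deg ⟨
      ∑[ u < N ] (nonNeighbours u + deg u)  ≡⟨ sum-cong-≗ (λ u → m∸n+n≡m (deg≤oppositePart u)) ⟩
      ∑[ u < N ] oppositePart u             ≡⟨ sum-cong-≗ oppositePart≡ ⟩
      ∑[ u < N ] (part false * ind (side u) + part true * ind (not (side u)))
        ≡⟨ ∑-distrib-+ (λ u → part false * ind (side u)) (λ u → part true * ind (not (side u))) ⟩
      ∑[ u < N ] (part false * ind (side u)) + ∑[ u < N ] (part true * ind (not (side u)))
        ≡⟨ cong₂ _+_ (*-distribˡ-sum (part false) (ind ∘ side)) (*-distribˡ-sum (part true) (ind ∘ not ∘ side)) ⟨
      part false * ∑[ u < N ] ind (side u) + part true * ∑[ u < N ] ind (not (side u))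
        ≡⟨ cong₂ (λ x y → part false * x + part true * y) (countV≡∑ side) (countV≡∑ (not ∘ side)) ⟨
      part false * part true + part true * part false
        ≡⟨ twice (part false) (part true) ⟩
      2 * (part false * part true) ∎
      where
      open ≡-Reasoning
      oppositePart≡ : ∀ u → oppositePart u ≡ part false * ind (side u) + part true * ind (not (side u))
      oppositePart≡ u with side u
      ... | true  = sym (trans (cong₂ _+_ (*-identityʳ (part false)) (*-zeroʳ (part true))) (+-identityʳ _))
      ... | false = sym (trans (cong (_+ part true * 1) (*-zeroʳ (part false))) (*-identityʳ (part true)))
      twice : ∀ a b → a * b + b * a ≡ 2 * (a * b)
      twice a b = solve (a ∷ b ∷ [])

    M≤2n₁n₂ : M ≤ 2 * (part false * part true)
    M≤2n₁n₂ = subst (M ≤_) K+M≡2n₁n₂ (m≤n+m M K)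

    ordered-gap : Fin N → Fin N → ℕ
    ordered-gap u v = if adj G u v ∧ (toℕ u <ᵇ toℕ v) then nₑ-gap u v else 0

    edge-gap : Fin N → Fin N → ℕ
    edge-gap u v = ind (adj G u v) * nₑ-gap u v

    ordered-gap-pair : ∀ u v → ordered-gap u v + ordered-gap v u ≤ edge-gap u v
    ordered-gap-pair u v rewrite Graph.sym G v u with adj G u v
    ... | false = z≤n
    ... | true with toℕ u <ᵇ toℕ v in u<v | toℕ v <ᵇ toℕ u in v<u
    ...   | true  | true  = ⊥-elim (<-asym (<ᵇ⇒< (toℕ u) (toℕ v) (subst T (sym u<v) _)) (<ᵇ⇒< (toℕ v) (toℕ u) (subst T (sym v<u) _)))
    ...   | true  | false = ≤-reflexive (trans (+-identityʳ _) (sym (+-identityʳ _)))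
    ...   | false | true  = ≤-reflexive (trans (∣-∣-comm (nₑ G v u) (nₑ G u v)) (sym (+-identityʳ _)))
    ...   | false | false = z≤n

    2Mo≤∑edge-gap : Mostar G + Mostar G ≤ ∑[ u < N ] ∑[ v < N ] edge-gap u v
    2Mo≤∑edge-gap = begin
      Mostar G + Mostar G
        ≡⟨ cong₂ _+_ (sum-concatMap-allFin ordered-gap) (trans (sum-concatMap-allFin ordered-gap) (∑-comm ordered-gap)) ⟩
      ∑[ u < N ] ∑[ v < N ] ordered-gap u v + ∑[ u < N ] ∑[ v < N ] ordered-gap v u
        ≡⟨ ∑-distrib-+ (λ u → ∑[ v < N ] ordered-gap u v) (λ u → ∑[ v < N ] ordered-gap v u) ⟨
      ∑[ u < N ] (∑[ v < N ] ordered-gap u v + ∑[ v < N ] ordered-gap v u)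
        ≡⟨ sum-cong-≗ (λ u → ∑-distrib-+ (ordered-gap u) (λ v → ordered-gap v u)) ⟨
      ∑[ u < N ] ∑[ v < N ] (ordered-gap u v + ordered-gap v u)
        ≤⟨ ∑-mono-≤ (λ u → ∑-mono-≤ (ordered-gap-pair u)) ⟩
      ∑[ u < N ] ∑[ v < N ] edge-gap u v ∎
      where open ≤-Reasoning

    edge-gap² : Fin N → Fin N → ℕ
    edge-gap² u v = ind (adj G u v) * (nₑ-gap u v * nₑ-gap u v)

    edge-gap-cauchy-schwarz :
      (∑[ u < N ] ∑[ v < N ] edge-gap u v) * (∑[ u < N ] ∑[ v < N ] edge-gap u v) ≤ M * ∑[ u < N ] ∑[ v < N ] edge-gap² u v
    edge-gap-cauchy-schwarz =
      cauchy-schwarz _ deg _ (λ u → cauchy-schwarz (edge-gap u) (ind ∘ adj G u) (edge-gap² u) (λ v → ind-square (adj G u v) (nₑ-gap u v)))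
      where
      ind-square : ∀ b x → ind b * x * (ind b * x) ≤ ind b * (ind b * (x * x))
      ind-square false x = z≤n
      ind-square true  x = ≤-reflexive (solve (x ∷ []))

    ∑edge-gap²-bound : ∑[ u < N ] ∑[ v < N ] edge-gap² u v ≤ imbalance * imbalance * M + 4 * K * M + 4 * M * K
    ∑edge-gap²-bound = begin
      ∑[ u < N ] ∑[ v < N ] edge-gap² u v
        ≤⟨ ∑-mono-≤ (λ u → ∑-mono-≤ (edge-gap²-bound u)) ⟩
      ∑[ u < N ] ∑[ v < N ] (imbalance * imbalance * ind (adj G u v) + 4 * deg u * nonNeighbours v + 4 * nonNeighbours u * deg v)
        ≡⟨ sum-cong-≗ (λ u → ∑-linear₃ (imbalance * imbalance) (4 * deg u) (4 * nonNeighbours u) (ind ∘ adj G u) nonNeighbours deg) ⟩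
      ∑[ u < N ] (imbalance * imbalance * deg u + 4 * deg u * K + 4 * nonNeighbours u * M)
        ≡⟨ sum-cong-≗ (λ u → reorder (imbalance * imbalance) (deg u) (nonNeighbours u) K M) ⟩
      ∑[ u < N ] (imbalance * imbalance * deg u + 4 * K * deg u + 4 * M * nonNeighbours u)
        ≡⟨ ∑-linear₃ (imbalance * imbalance) (4 * K) (4 * M) deg deg nonNeighbours ⟩
      imbalance * imbalance * M + 4 * K * M + 4 * M * K ∎
      where
      open ≤-Reasoning
      reorder : ∀ a d n k m → a * d + 4 * d * k + 4 * n * m ≡ a * d + 4 * k * d + 4 * m * n
      reorder a d n k m = solve (a ∷ d ∷ n ∷ k ∷ m ∷ [])
      edge-gap²-bound : ∀ u v → edge-gap² u v ≤ imbalance * imbalance * ind (adj G u v) + 4 * deg u * nonNeighbours v + 4 * nonNeighbours u * deg v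
      edge-gap²-bound u v with adj G u v in uv
      ... | false = z≤n
      ... | true  = subst₂ _≤_ (sym (*-identityˡ _)) (cong (λ a → a + 4 * deg u * nonNeighbours v + 4 * nonNeighbours u * deg v) (sym (*-identityʳ (imbalance * imbalance)))) (nₑ-gap-bound {u} {v} uv)

    mostar-inequality :
      4 * (Mostar G * Mostar G) + 8 * (M * M * M) ≤ M * M * (imbalance * imbalance) + 16 * (part false * part true) * (M * M)
    mostar-inequality = mostar-cubic-form {Mostar G} {M} {K} {part false * part true} {imbalance} (begin
      4 * (Mostar G * Mostar G)                                   ≡⟨ four-squares (Mostar G) ⟩
      (Mostar G + Mostar G) * (Mostar G + Mostar G)               ≤⟨ *-mono-≤ 2Mo≤∑edge-gap 2Mo≤∑edge-gap ⟩
      (∑[ u < N ] ∑[ v < N ] edge-gap u v) * (∑[ u < N ] ∑[ v < N ] edge-gap u v) ≤⟨ edge-gap-cauchy-schwarz ⟩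
      M * ∑[ u < N ] ∑[ v < N ] edge-gap² u v                      ≤⟨ *-monoʳ-≤ M ∑edge-gap²-bound ⟩
      M * (imbalance * imbalance * M + 4 * K * M + 4 * M * K)      ∎) K+M≡2n₁n₂
      where
      open ≤-Reasoning
      four-squares : ∀ x → 4 * (x * x) ≡ (x + x) * (x + x)
      four-squares x = solve (x ∷ [])

module _ where
  open import Data.Nat.Base as ℕ using () renaming (_*_ to _*ℕ_; _≤_ to _≤ℕ_)
  import Data.Nat.Coprimality as Coprimality
  open import Data.Integer.Base as ℤ using ()
  import Data.Integer.Properties as ℤ
  open import Data.Rational.Base using (mkℚ; 0ℚ; *≤*; _-_; -_; _≤_; nonNegative; nonPositive)
  import Data.Rational.Properties as ℚ
  open import Data.Rational.Solver using (module +-*-Solver)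
  open import Data.Sum.Base using (_⊎_; inj₁; inj₂)
  open import Relation.Nullary using (yes; no)

  -- From ℕ to ℚ

  ℕ→ℚ≡mkℚ : ∀ n → ℕ→ℚ n ≡ mkℚ (+ n) 0 (Coprimality.sym (Coprimality.1-coprimeTo n))
  ℕ→ℚ≡mkℚ n = ℚ.↥p/↧p≡p _

  ℕ→ℚ-+ : ∀ m n → ℕ→ℚ (m + n) ≡ ℕ→ℚ m +ℚ ℕ→ℚ n
  ℕ→ℚ-+ m n rewrite ℕ→ℚ≡mkℚ m | ℕ→ℚ≡mkℚ n =
    ℚ./-cong (trans (ℤ.pos-+ m n) (sym (cong₂ ℤ._+_ (ℤ.*-identityʳ (+ m)) (ℤ.*-identityʳ (+ n))))) refl

  ℕ→ℚ-* : ∀ m n → ℕ→ℚ (m *ℕ n) ≡ ℕ→ℚ m *ℚ ℕ→ℚ n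
  ℕ→ℚ-* m n rewrite ℕ→ℚ≡mkℚ m | ℕ→ℚ≡mkℚ n = cong (_/ 1) (ℤ.pos-* m n)

  ℕ→ℚ-mono-≤ : ∀ {m n} → m ≤ℕ n → ℕ→ℚ m ≤ ℕ→ℚ n
  ℕ→ℚ-mono-≤ {m} {n} m≤n rewrite ℕ→ℚ≡mkℚ m | ℕ→ℚ≡mkℚ n =
    *≤* (subst₂ ℤ._≤_ (sym (ℤ.*-identityʳ (+ m))) (sym (ℤ.*-identityʳ (+ n))) (ℤ.+≤+ m≤n))

  0≤ℕ→ℚ : ∀ n → 0ℚ ≤ ℕ→ℚ n
  0≤ℕ→ℚ n = ℕ→ℚ-mono-≤ {0} {n} ℕ.z≤n

  infixl 6 _⊕_
  infixl 7 _⊗_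

  data ℕExpr : Set where
    ⌜_⌝     : ℕ → ℕExpr
    _⊕_ _⊗_ : ℕExpr → ℕExpr → ℕExpr

  ⟦_⟧ℕ : ℕExpr → ℕ
  ⟦ ⌜ n ⌝ ⟧ℕ = n
  ⟦ e ⊕ f ⟧ℕ = ⟦ e ⟧ℕ + ⟦ f ⟧ℕ
  ⟦ e ⊗ f ⟧ℕ = ⟦ e ⟧ℕ *ℕ ⟦ f ⟧ℕ

  ⟦_⟧ℚ : ℕExpr → ℚ
  ⟦ ⌜ n ⌝ ⟧ℚ = ℕ→ℚ n
  ⟦ e ⊕ f ⟧ℚ = ⟦ e ⟧ℚ +ℚ ⟦ f ⟧ℚ
  ⟦ e ⊗ f ⟧ℚ = ⟦ e ⟧ℚ *ℚ ⟦ f ⟧ℚ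

  ℕ→ℚ-⟦⟧ : ∀ e → ℕ→ℚ ⟦ e ⟧ℕ ≡ ⟦ e ⟧ℚ
  ℕ→ℚ-⟦⟧ ⌜ n ⌝   = refl
  ℕ→ℚ-⟦⟧ (e ⊕ f) = trans (ℕ→ℚ-+ ⟦ e ⟧ℕ ⟦ f ⟧ℕ) (cong₂ _+ℚ_ (ℕ→ℚ-⟦⟧ e) (ℕ→ℚ-⟦⟧ f))
  ℕ→ℚ-⟦⟧ (e ⊗ f) = trans (ℕ→ℚ-* ⟦ e ⟧ℕ ⟦ f ⟧ℕ) (cong₂ _*ℚ_ (ℕ→ℚ-⟦⟧ e) (ℕ→ℚ-⟦⟧ f))

  ℕ→ℚ-⟦⟧-≡ : ∀ e f → ⟦ e ⟧ℕ ≡ ⟦ f ⟧ℕ → ⟦ e ⟧ℚ ≡ ⟦ f ⟧ℚ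
  ℕ→ℚ-⟦⟧-≡ e f eq = trans (sym (ℕ→ℚ-⟦⟧ e)) (trans (cong ℕ→ℚ eq) (ℕ→ℚ-⟦⟧ f))

  ℕ→ℚ-⟦⟧-≤ : ∀ e f → ⟦ e ⟧ℕ ≤ℕ ⟦ f ⟧ℕ → ⟦ e ⟧ℚ ≤ ⟦ f ⟧ℚ
  ℕ→ℚ-⟦⟧-≤ e f le = subst₂ _≤_ (ℕ→ℚ-⟦⟧ e) (ℕ→ℚ-⟦⟧ f) (ℕ→ℚ-mono-≤ le)

  0≤q-p : ∀ {p q} → p ≤ q → 0ℚ ≤ q - p
  0≤q-p {p} {q} p≤q = subst (_≤ q - p) (ℚ.+-inverseʳ p) (ℚ.+-monoˡ-≤ (- p) p≤q)

  0≤p*q : ∀ {p q} → 0ℚ ≤ p → 0ℚ ≤ q → 0ℚ ≤ p *ℚ q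
  0≤p*q {p} {q} 0≤p 0≤q = subst (_≤ p *ℚ q) (ℚ.*-zeroʳ p) (ℚ.*-monoˡ-≤-nonNeg p {{nonNegative 0≤p}} 0≤q)

  -- The library's nonPos*nonPos⇒nonPos concludes NonNegative, despite its name.
  0≤p*p : ∀ p → 0ℚ ≤ p *ℚ p
  0≤p*p p with ℚ.≤-total 0ℚ p
  ... | inj₁ 0≤p = 0≤p*q 0≤p 0≤p
  ... | inj₂ p≤0 = ℚ.nonNegative⁻¹ _ {{ℚ.nonPos*nonPos⇒nonPos p {{nonPositive p≤0}} p {{nonPositive p≤0}}}}

  *-self-mono-≤ : ∀ {p q} → 0ℚ ≤ p → p ≤ q → p *ℚ p ≤ q *ℚ q
  *-self-mono-≤ {p} {q} 0≤p p≤q = ℚ.≤-trans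
    (ℚ.*-monoˡ-≤-nonNeg p {{nonNegative 0≤p}} p≤q)
    (ℚ.*-monoʳ-≤-nonNeg q {{nonNegative (ℚ.≤-trans 0≤p p≤q)}} p≤q)

  p≤p+q : ∀ p {q} → 0ℚ ≤ q → p ≤ p +ℚ q
  p≤p+q p {q} 0≤q = subst (_≤ p +ℚ q) (ℚ.+-identityʳ p) (ℚ.+-monoʳ-≤ p 0≤q)

  -- The cubic bound

  cubicT : ℚ → ℚ → ℚ → ℚ
  cubicT p s x = ℕ→ℚ 108 *ℚ x +ℚ ℕ→ℚ 16 *ℚ (p *ℚ p *ℚ p) - ℕ→ℚ 36 *ℚ (p *ℚ p) *ℚ s

  cubicQ : ℚ → ℚ → ℚ
  cubicQ p s = ℕ→ℚ 4 *ℚ (p *ℚ p) +ℚ ℕ→ℚ 3 *ℚ p *ℚ s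

  -- x ≤ (36p²s − 16p³ + 2Q^{3/2})/108, written without square roots as in LeSqrtNested.
  CubicMaxBound : ℚ → ℚ → ℚ → Set
  CubicMaxBound p s x = let T = cubicT p s x ; Q = cubicQ p s in
    T ≤ 0ℚ ⊎ T *ℚ T ≤ ℕ→ℚ 4 *ℚ (Q *ℚ Q *ℚ Q)

  module Rescaling (x q₁ q₂ q : ℚ) where
    open +-*-Solver

    c : ∀ {n} → ℕ → Polynomial n
    c k = con (ℕ→ℚ k)

    B C t : ℚ
    B = (q₁ *ℚ q₁ *ℚ q₂ *ℚ q₂) *ℚ ((+ 2) / 27) +ℚ (q₁ *ℚ q₂ *ℚ q *ℚ q) *ℚ ((+ 1) / 18)
    C = ℕ→ℚ 4 *ℚ q₁ *ℚ q₁ *ℚ q₂ *ℚ q₂ +ℚ ℕ→ℚ 3 *ℚ q₁ *ℚ q₂ *ℚ q *ℚ q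
    t = x *ℚ x - (q₁ *ℚ q₁ *ℚ q₂ *ℚ q₂ *ℚ q *ℚ q) *ℚ ((+ 1) / 3) +ℚ (q₁ *ℚ q₁ *ℚ q₁ *ℚ q₂ *ℚ q₂ *ℚ q₂) *ℚ ((+ 4) / 27)

    108t≡T : ℕ→ℚ 108 *ℚ t ≡ cubicT (q₁ *ℚ q₂) (q *ℚ q) (x *ℚ x)
    108t≡T = solve 4 (λ x q₁ q₂ q →
      c 108 :* (x :* x :- (q₁ :* q₁ :* q₂ :* q₂ :* q :* q) :* con ((+ 1) / 3) :+ (q₁ :* q₁ :* q₁ :* q₂ :* q₂ :* q₂) :* con ((+ 4) / 27))
        := c 108 :* (x :* x) :+ c 16 :* ((q₁ :* q₂) :* (q₁ :* q₂) :* (q₁ :* q₂)) :- c 36 :* ((q₁ :* q₂) :* (q₁ :* q₂)) :* (q :* q))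
      refl x q₁ q₂ q

    T²≡11664t² : cubicT (q₁ *ℚ q₂) (q *ℚ q) (x *ℚ x) *ℚ cubicT (q₁ *ℚ q₂) (q *ℚ q) (x *ℚ x) ≡ ℕ→ℚ 11664 *ℚ (t *ℚ t)
    T²≡11664t² = trans (cong (λ T → T *ℚ T) (sym 108t≡T)) (solve 1 (λ t → (c 108 :* t) :* (c 108 :* t) := c 11664 :* (t :* t)) refl t)

    4Q³≡11664B²C : let Q = cubicQ (q₁ *ℚ q₂) (q *ℚ q) in ℕ→ℚ 4 *ℚ (Q *ℚ Q *ℚ Q) ≡ ℕ→ℚ 11664 *ℚ (B *ℚ B *ℚ C)
    4Q³≡11664B²C = solve 3 (λ q₁ q₂ q →
      let B = (q₁ :* q₁ :* q₂ :* q₂) :* con ((+ 2) / 27) :+ (q₁ :* q₂ :* q :* q) :* con ((+ 1) / 18)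
          C = c 4 :* q₁ :* q₁ :* q₂ :* q₂ :+ c 3 :* q₁ :* q₂ :* q :* q
          Q = c 4 :* ((q₁ :* q₂) :* (q₁ :* q₂)) :+ c 3 :* (q₁ :* q₂) :* (q :* q)
      in c 4 :* (Q :* Q :* Q) := c 11664 :* (B :* B :* C)) refl q₁ q₂ q

  -- T ≤ H, where H replaces 108x in T by the upper bound 27(2pα²m + 16pm² − 8m³) that the hypothesis
  -- and m ≤ 2p give, and 4Q³ − H² = 108 L² q with q ≥ 0.
  module CubicMax (p α m x : ℚ) where
    open +-*-Solver

    c : ∀ {n} → ℕ → Polynomial n
    c k = con (ℕ→ℚ k)

    s H L k slack : ℚ
    s = α *ℚ α +ℚ ℕ→ℚ 4 *ℚ p
    H = ℕ→ℚ 27 *ℚ (ℕ→ℚ 16 *ℚ p *ℚ (m *ℚ m) +ℚ ℕ→ℚ 2 *ℚ p *ℚ (α *ℚ α) *ℚ m - ℕ→ℚ 8 *ℚ (m *ℚ m *ℚ m))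
        +ℚ ℕ→ℚ 16 *ℚ (p *ℚ p *ℚ p) - ℕ→ℚ 36 *ℚ (p *ℚ p) *ℚ s
    L = ℕ→ℚ 12 *ℚ (m *ℚ m) - ℕ→ℚ 16 *ℚ p *ℚ m - p *ℚ (α *ℚ α)
    k = ℕ→ℚ 2 *ℚ p - m
    slack = (m *ℚ m *ℚ (α *ℚ α) +ℚ ℕ→ℚ 16 *ℚ p *ℚ (m *ℚ m)) - (ℕ→ℚ 4 *ℚ x +ℚ ℕ→ℚ 8 *ℚ (m *ℚ m *ℚ m))

    H≡T+27[slack+α²mk] : H ≡ cubicT p s x +ℚ ℕ→ℚ 27 *ℚ (slack +ℚ α *ℚ α *ℚ m *ℚ k)
    H≡T+27[slack+α²mk] = solve 4 (λ p α m x →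
      let s = α :* α :+ c 4 :* p
      in c 27 :* (c 16 :* p :* (m :* m) :+ c 2 :* p :* (α :* α) :* m :- c 8 :* (m :* m :* m))
           :+ c 16 :* (p :* p :* p) :- c 36 :* (p :* p) :* s
         := c 108 :* x :+ c 16 :* (p :* p :* p) :- c 36 :* (p :* p) :* s
           :+ c 27 :* (((m :* m :* (α :* α) :+ c 16 :* p :* (m :* m)) :- (c 4 :* x :+ c 8 :* (m :* m :* m)))
                       :+ α :* α :* m :* (c 2 :* p :- m))) refl p α m x

    4Q³≡H²+108L²[4mk+k²+pα²] :
      ℕ→ℚ 4 *ℚ (cubicQ p s *ℚ cubicQ p s *ℚ cubicQ p s)
        ≡ H *ℚ H +ℚ ℕ→ℚ 108 *ℚ (L *ℚ L) *ℚ (ℕ→ℚ 4 *ℚ m *ℚ k +ℚ k *ℚ k +ℚ p *ℚ (α *ℚ α))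
    4Q³≡H²+108L²[4mk+k²+pα²] = solve 3 (λ p α m →
      let s = α :* α :+ c 4 :* p
          Q = c 4 :* (p :* p) :+ c 3 :* p :* s
          H = c 27 :* (c 16 :* p :* (m :* m) :+ c 2 :* p :* (α :* α) :* m :- c 8 :* (m :* m :* m))
              :+ c 16 :* (p :* p :* p) :- c 36 :* (p :* p) :* s
          L = c 12 :* (m :* m) :- c 16 :* p :* m :- p :* (α :* α)
          k = c 2 :* p :- m
      in c 4 :* (Q :* Q :* Q) := H :* H :+ c 108 :* (L :* L) :* (c 4 :* m :* k :+ k :* k :+ p :* (α :* α))) refl p α m

    cubic-max-bound : 0ℚ ≤ p → 0ℚ ≤ m → m ≤ ℕ→ℚ 2 *ℚ p →
      ℕ→ℚ 4 *ℚ x +ℚ ℕ→ℚ 8 *ℚ (m *ℚ m *ℚ m) ≤ m *ℚ m *ℚ (α *ℚ α) +ℚ ℕ→ℚ 16 *ℚ p *ℚ (m *ℚ m) →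
      CubicMaxBound p s x
    cubic-max-bound 0≤p 0≤m m≤2p hyp with cubicT p s x ℚ.≤? 0ℚ
    ... | yes T≤0 = inj₁ T≤0
    ... | no T≰0 = inj₂ (begin
      T *ℚ T
        ≤⟨ *-self-mono-≤ (ℚ.<⇒≤ (ℚ.≰⇒> T≰0)) T≤H ⟩
      H *ℚ H
        ≤⟨ p≤p+q (H *ℚ H) (0≤p*q (0≤p*q (0≤ℕ→ℚ 108) (0≤p*p L)) 0≤q) ⟩
      H *ℚ H +ℚ ℕ→ℚ 108 *ℚ (L *ℚ L) *ℚ (ℕ→ℚ 4 *ℚ m *ℚ k +ℚ k *ℚ k +ℚ p *ℚ (α *ℚ α))
        ≡⟨ 4Q³≡H²+108L²[4mk+k²+pα²] ⟨
      ℕ→ℚ 4 *ℚ (Q *ℚ Q *ℚ Q) ∎)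
      where
      open ℚ.≤-Reasoning
      T Q : ℚ
      T = cubicT p s x
      Q = cubicQ p s
      0≤k : 0ℚ ≤ k
      0≤k = 0≤q-p m≤2p
      0≤q : 0ℚ ≤ ℕ→ℚ 4 *ℚ m *ℚ k +ℚ k *ℚ k +ℚ p *ℚ (α *ℚ α)
      0≤q = ℚ.+-mono-≤ (ℚ.+-mono-≤ (0≤p*q (0≤p*q (0≤ℕ→ℚ 4) 0≤m) 0≤k) (0≤p*p k)) (0≤p*q 0≤p (0≤p*p α))
      T≤H : T ≤ H
      T≤H = subst (T ≤_) (sym H≡T+27[slack+α²mk])
              (p≤p+q T (0≤p*q (0≤ℕ→ℚ 27) (ℚ.+-mono-≤ (0≤q-p hyp) (0≤p*q (0≤p*q (0≤p*p α) 0≤m) 0≤k))))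

  ℕ-cubic⇒CubicMaxBound : ∀ mo M n₁ n₂ a →
    4 *ℕ (mo *ℕ mo) + 8 *ℕ (M *ℕ M *ℕ M) ≤ℕ M *ℕ M *ℕ (a *ℕ a) + 16 *ℕ (n₁ *ℕ n₂) *ℕ (M *ℕ M) →
    M ≤ℕ 2 *ℕ (n₁ *ℕ n₂) → a *ℕ a + 4 *ℕ (n₁ *ℕ n₂) ≡ (n₁ + n₂) *ℕ (n₁ + n₂) →
    CubicMaxBound (ℕ→ℚ n₁ *ℚ ℕ→ℚ n₂) (ℕ→ℚ (n₁ + n₂) *ℚ ℕ→ℚ (n₁ + n₂)) (ℕ→ℚ mo *ℚ ℕ→ℚ mo)
  ℕ-cubic⇒CubicMaxBound mo M n₁ n₂ a cubic M≤2n₁n₂ a²+4n₁n₂≡n² =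
    subst (λ s → CubicMaxBound ⟦ ⌜n₁n₂⌝ ⟧ℚ s (ℕ→ℚ mo *ℚ ℕ→ℚ mo))
      (ℕ→ℚ-⟦⟧-≡ (⌜ a ⌝ ⊗ ⌜ a ⌝ ⊕ ⌜ 4 ⌝ ⊗ ⌜n₁n₂⌝) (⌜ n₁ + n₂ ⌝ ⊗ ⌜ n₁ + n₂ ⌝) a²+4n₁n₂≡n²)
      (CubicMax.cubic-max-bound ⟦ ⌜n₁n₂⌝ ⟧ℚ (ℕ→ℚ a) (ℕ→ℚ M) (ℕ→ℚ mo *ℚ ℕ→ℚ mo)
        (ℕ→ℚ-⟦⟧-≤ ⌜ 0 ⌝ ⌜n₁n₂⌝ ℕ.z≤n) (0≤ℕ→ℚ M) (ℕ→ℚ-⟦⟧-≤ ⌜ M ⌝ (⌜ 2 ⌝ ⊗ ⌜n₁n₂⌝) M≤2n₁n₂)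
        (ℕ→ℚ-⟦⟧-≤ (⌜ 4 ⌝ ⊗ (⌜ mo ⌝ ⊗ ⌜ mo ⌝) ⊕ ⌜ 8 ⌝ ⊗ (⌜ M ⌝ ⊗ ⌜ M ⌝ ⊗ ⌜ M ⌝))
                  (⌜ M ⌝ ⊗ ⌜ M ⌝ ⊗ (⌜ a ⌝ ⊗ ⌜ a ⌝) ⊕ ⌜ 16 ⌝ ⊗ ⌜n₁n₂⌝ ⊗ (⌜ M ⌝ ⊗ ⌜ M ⌝)) cubic))
    where
    ⌜n₁n₂⌝ : ℕExpr
    ⌜n₁n₂⌝ = ⌜ n₁ ⌝ ⊗ ⌜ n₂ ⌝

  CubicMaxBound⇒LeSqrtNested : ∀ x q₁ q₂ q → CubicMaxBound (q₁ *ℚ q₂) (q *ℚ q) (x *ℚ x) →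
    let A  = (q₁ *ℚ q₁ *ℚ q₂ *ℚ q₂ *ℚ q *ℚ q) *ℚ ((+ 1) / 3)
        B  = (q₁ *ℚ q₁ *ℚ q₂ *ℚ q₂) *ℚ ((+ 2) / 27) +ℚ (q₁ *ℚ q₂ *ℚ q *ℚ q) *ℚ ((+ 1) / 18)
        C  = ℕ→ℚ 4 *ℚ q₁ *ℚ q₁ *ℚ q₂ *ℚ q₂ +ℚ ℕ→ℚ 3 *ℚ q₁ *ℚ q₂ *ℚ q *ℚ q
        D  = (q₁ *ℚ q₁ *ℚ q₁ *ℚ q₂ *ℚ q₂ *ℚ q₂) *ℚ ((+ 4) / 27)
    in LeSqrtNested x A B C D
  CubicMaxBound⇒LeSqrtNested x q₁ q₂ q (inj₁ T≤0) =
    inj₁ (ℚ.*-cancelˡ-≤-pos (ℕ→ℚ 108) (subst (_≤ ℕ→ℚ 108 *ℚ 0ℚ) (sym 108t≡T) T≤0))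
    where open Rescaling x q₁ q₂ q
  CubicMaxBound⇒LeSqrtNested x q₁ q₂ q (inj₂ T²≤4Q³) =
    inj₂ (ℚ.*-cancelˡ-≤-pos (ℕ→ℚ 11664) (subst₂ _≤_ T²≡11664t² 4Q³≡11664B²C T²≤4Q³))
    where open Rescaling x q₁ q₂ q

corollary3p7 : (N : ℕ) (G : Graph N) (side : Fin N → Bool) →
    IsBipartition G side → HasDiameter G 3 →
    let n₁ = countV G (λ w → not (side w))
        n₂ = countV G side
        n  = n₁ + n₂
        q₁ = ℕ→ℚ n₁
        q₂ = ℕ→ℚ n₂
        q  = ℕ→ℚ n
        A  = (q₁ *ℚ q₁ *ℚ q₂ *ℚ q₂ *ℚ q *ℚ q) *ℚ ((+ 1) / 3)
        B  = (q₁ *ℚ q₁ *ℚ q₂ *ℚ q₂) *ℚ ((+ 2) / 27) +ℚ (q₁ *ℚ q₂ *ℚ q *ℚ q) *ℚ ((+ 1) / 18)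
        C  = ℕ→ℚ 4 *ℚ q₁ *ℚ q₁ *ℚ q₂ *ℚ q₂ +ℚ ℕ→ℚ 3 *ℚ q₁ *ℚ q₂ *ℚ q *ℚ q
        D  = (q₁ *ℚ q₁ *ℚ q₁ *ℚ q₂ *ℚ q₂ *ℚ q₂) *ℚ ((+ 4) / 27)
    in LeSqrtNested (ℕ→ℚ (Mostar G)) A B C D
corollary3p7 N G side bipartite (connected , dist≤3 , _) =
  CubicMaxBound⇒LeSqrtNested (ℕ→ℚ (Mostar G)) (ℕ→ℚ (part false)) (ℕ→ℚ (part true)) (ℕ→ℚ (part false + part true))
    (ℕ-cubic⇒CubicMaxBound (Mostar G) M (part false) (part true) imbalance
      mostar-inequality M≤2n₁n₂ (∣m-n∣²+4mn≡[m+n]² (part false) (part true)))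
  where open Diameter3 G bipartite connected dist≤3
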